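{- Let $q$ be a prime power, $v\ge 1$, $\Delta>1$ an integer, and let $\mathcal{P}$ be the set of points of $\mathrm{PG}(v-1,\mathbb{F}_q)$. Let $\mathcal{C}\subseteq\mathcal{P}$ with $\mathcal{C}\neq\emptyset$ and $\mathcal{C}\ne\mathcal{P}$ be weakly $\Delta$-divisible, and let $n=|\mathcal{C}|$. Let $G\in\mathbb{F}_q^{v\times n}$ be a matrix whose columns are nonzero representatives of the $n$ points of $\mathcal{C}$ (one column per point), and let $C$ be the linear code of length $n$ over $\mathbb{F}_q$ spanned by the rows of $G$. Then: (i) $\mathcal{C}$ is strongly $\Delta$-divisible; (ii) every nonzero codeword of $C$ has Hamming weight divisible by $\Delta$; (iii) $\Delta$ divides $q^{v-2}$.
   Context: Points of $\mathrm{PG}(v-1,\mathbb{F}_q)$ are the $1$-dimensional subspaces of $\mathbb{F}_q^v$, hyperplanes are the $(v-1)$-dimensional subspaces; a point lies in a hyperplane $H$ if it is contained in $H$, and $\mathcal{C}\cap H$ denotes the set of points of $\mathcal{C}$ contained in $H$. For an integer $\Delta>1$, a point set $\mathcal{C}$ is weakly $\Delta$-divisible if there is an integer $u$ with $|\mathcal{C}\cap H|\equiv u\pmod{\Delta}$ for every hyperplane $H$; it is (strongly) $\Delta$-divisible if moreover this holds with $u=|\mathcal{C}|$, i.e. $|\mathcal{C}\cap H|\equiv|\mathcal{C}|\pmod\Delta$ for every hyperplane $H$. -}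

module Defs where

open import Data.Nat as ℕ using (ℕ; _^_; _≥_; _∸_)
open import Data.Nat.Primality using (Prime)
open import Data.Fin using (Fin; zero; suc)
open import Data.List using (length; filter; allFin)
open import Data.Product using (Σ; ∃; _×_)
open import Data.Integer as ℤ using (ℤ; +_)
open import Data.Integer.Divisibility using () renaming (_∣_ to _∣ℤ_)
open import Relation.Nullary using (¬_; Dec)
open import Relation.Binary.PropositionalEquality using (_≡_; _≢_)
open import Relation.Binary.Definitions using (DecidableEquality)
open import Algebra.Structures using (IsCommutativeRing)
open import Function.Bundles using (_↔_)

IsPrimePower : ℕ → Set
IsPrimePower q = Σ ℕ λ p → Σ ℕ λ k → Prime p × k ≥ 1 × q ≡ p ^ k

record FiniteField (q : ℕ) : Set₁ where
  infixl 7 _*_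
  infixl 6 _+_
  field
    Carrier  : Set
    _+_ _*_  : Carrier → Carrier → Carrier
    -_       : Carrier → Carrier
    0# 1#    : Carrier
    isCommutativeRing : IsCommutativeRing _≡_ _+_ _*_ -_ 0# 1#
    0≢1      : 0# ≢ 1#
    inverse  : ∀ x → x ≢ 0# → Σ Carrier λ y → x * y ≡ 1#
    _≟_      : DecidableEquality Carrier
    enumeration : Fin q ↔ Carrier

module Geometry {q : ℕ} (F : FiniteField q) where
  open FiniteField F

  Vector : ℕ → Set
  Vector v = Fin v → Carrier

  zeroVec : ∀ {v} → Vector v
  zeroVec _ = 0#

  NonZeroVec : ∀ {v} → Vector v → Set
  NonZeroVec x = ¬ (∀ i → x i ≡ 0#)

  dot : ∀ {v} → Vector v → Vector v → Carrier
  dot {ℕ.zero}  a x = 0#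
  dot {ℕ.suc v} a x = a zero * x zero + dot (λ i → a (suc i)) (λ i → x (suc i))

  SamePoint : ∀ {v} → Vector v → Vector v → Set
  SamePoint x y = Σ Carrier λ λ' → λ' ≢ 0# × (∀ i → y i ≡ λ' * x i)

  countWhere : ∀ {n} (P : Fin n → Set) → (∀ j → Dec (P j)) → ℕ
  countWhere {n} P P? = length (filter P? (allFin n))

  -- A point set C of PG(v-1,q) of size n, given by n representative vectors
  -- g j (the columns of the generator matrix G), nonzero and pairwise
  -- representing distinct points.
  record PointSet (v n : ℕ) : Set where
    field
      col       : Fin n → Vector v
      nonzero   : ∀ j → NonZeroVec (col j)
      distinct  : ∀ j k → SamePoint (col j) (col k) → j ≡ k

  module _ {v n : ℕ} (C : PointSet v n) where
    open PointSet C

    -- |C ∩ H_a| where H_a = { <x> : a·x = 0 } is the hyperplane with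
    -- nonzero normal vector a (every hyperplane of PG(v-1,q) is of this form).
    hyperplaneCount : Vector v → ℕ
    hyperplaneCount a = countWhere (λ j → dot a (col j) ≡ 0#) (λ j → dot a (col j) ≟ 0#)

    -- codeword x·G of the code spanned by the rows of G: its j-th entry is x·g_j
    codeword : Vector v → Fin n → Carrier
    codeword x j = dot x (col j)

    weight : Vector v → ℕ
    weight x = countWhere (λ j → ¬ codeword x j ≡ 0#) (λ j → Relation.Nullary.¬? (codeword x j ≟ 0#))

    NotAllPoints : Set
    NotAllPoints = Σ (Vector v) λ x → NonZeroVec x × (∀ j → ¬ SamePoint (col j) x)

_≡_[mod_] : ℕ → ℕ → ℕ → Set
a ≡ b [mod Δ ] = (+ Δ) ∣ℤ ((+ a) ℤ.- (+ b))

module Divisibility {q : ℕ} (F : FiniteField q) where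
  open Geometry F

  WeaklyDivisible : ∀ {v n} → ℕ → PointSet v n → Set
  WeaklyDivisible {v} Δ C = Σ ℕ λ u → ∀ (a : Vector v) → NonZeroVec a →
                              hyperplaneCount C a ≡ u [mod Δ ]

  StronglyDivisible : ∀ {v n} → ℕ → PointSet v n → Set
  StronglyDivisible {v} {n} Δ C = ∀ (a : Vector v) → NonZeroVec a →
                              hyperplaneCount C a ≡ n [mod Δ ]

-- Let u be the common residue of |C ∩ H| mod Δ, and for w ≠ 0 let S(w) be the sum of |C ∩ a^⊥|
-- over all a ∈ F_q^v with a·w = 1. Every such a is nonzero, so S(w) ≡ u·q^(v-1) (mod Δ). Counted point by point, S(w) is
-- n·q^(v-2) when <w> lies outside C and (n-1)·q^(v-2) when <w> ∈ C; comparing the two gives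
-- Δ ∣ q^(v-2). Summing |C ∩ a^⊥| over all a counts incidences: n·q^(v-1) ≡ n + u·(q^v - 1),
-- whence n ≡ u. A codeword x·G with x ≠ 0 has weight n - |C ∩ x^⊥| ≡ n - u ≡ 0.
module Submission where

open import Defs
open import Data.Nat using (ℕ; _≥_; _>_; _^_; _∸_)
open import Data.Nat.Divisibility using (_∣_)
open import Data.Product using (_×_)
open import Relation.Nullary using (¬_)
open import Relation.Binary.PropositionalEquality using (_≡_)

open import Algebra.Bundles using (CommutativeRing)
open import Data.Empty using (⊥-elim)
open import Data.Fin as Fin using (Fin; zero; suc)
import Data.Fin.Properties as Finₚ
import Data.Integer as ℤ
import Data.Integer.Divisibility.Signed as ℤ∣
import Data.Integer.Properties as ℤₚ
import Data.Integer.Tactic.RingSolver as ℤ-Solver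
import Data.Nat.Tactic.RingSolver as ℕ-Solver
open import Data.List using (length; filter; tabulate)
open import Data.Nat as ℕ using (zero; suc; _+_; _*_)
import Data.Nat.Properties as ℕₚ
open import Data.Product using (Σ; _,_; proj₁; proj₂)
open import Data.Vec.Functional using (_∷_; map; zipWith)
open import Function.Base using (_∘_)
open import Function.Bundles using (_↔_; Inverse; mk↔ₛ′)
open import Function.Construct.Composition using (_↔-∘_)
open import Function.Construct.Symmetry using (↔-sym)
open import Relation.Binary.Bundles using (Setoid)
import Relation.Binary.Reasoning.Setoid
open import Relation.Binary.Core using (_Preserves_⟶_)
open import Relation.Binary.PropositionalEquality
  using (_≢_; refl; sym; trans; cong; cong₂; subst; subst₂; _≗_; module ≡-Reasoning)
open import Relation.Binary.Structures using (IsEquivalence)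
open import Relation.Nullary using (Dec; yes; no; ¬?)

open import Algebra.Properties.Semiring.Sum ℕₚ.+-*-semiring
  using (sum; sum-cong-≗; ∑-distrib-+; ∑-comm; sum-permute; *-distribˡ-sum; *-distribʳ-sum)

module Congruence (Δ : ℕ) where

  open ℤ using (+_)

  -- a record rather than a synonym, so that a and b can be inferred from a proof of a ≈ b
  infix 4 _≈_
  record _≈_ (a b : ℕ) : Set where
    constructor mk≈
    field divides : + Δ ℤ∣.∣ (+ a ℤ.- + b)

  private
    by : ∀ {a b} {x : ℤ.ℤ} → x ≡ + a ℤ.- + b → + Δ ℤ∣.∣ x → a ≈ b
    by eq Δ∣x = mk≈ (subst (+ Δ ℤ∣.∣_) eq Δ∣x)

  ≈-refl : ∀ {a} → a ≈ a
  ≈-refl {a} = by (sym (ℤₚ.+-inverseʳ (+ a))) (ℤ∣.divides (+ 0) refl)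

  ≈-sym : ∀ {a b} → a ≈ b → b ≈ a
  ≈-sym {a} {b} (mk≈ p) = by (negate-difference (+ a) (+ b)) (ℤ∣.∣m⇒∣-m p)
    where
    negate-difference : ∀ x y → ℤ.- (x ℤ.- y) ≡ y ℤ.- x
    negate-difference = ℤ-Solver.solve-∀

  ≈-trans : ∀ {a b c} → a ≈ b → b ≈ c → a ≈ c
  ≈-trans {a} {b} {c} (mk≈ p) (mk≈ r) = by (telescope (+ a) (+ b) (+ c)) (ℤ∣.∣m∣n⇒∣m+n p r)
    where
    telescope : ∀ x y z → (x ℤ.- y) ℤ.+ (y ℤ.- z) ≡ x ℤ.- z
    telescope = ℤ-Solver.solve-∀

  ≈-isEquivalence : IsEquivalence _≈_
  ≈-isEquivalence = record { refl = ≈-refl ; sym = ≈-sym ; trans = ≈-trans }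

  ≈-setoid : Setoid _ _
  ≈-setoid = record { isEquivalence = ≈-isEquivalence }

  module ≈-Reasoning = Relation.Binary.Reasoning.Setoid ≈-setoid

  ≡⇒≈ : ∀ {a b} → a ≡ b → a ≈ b
  ≡⇒≈ refl = ≈-refl

  +-cong : ∀ {a b c d} → a ≈ b → c ≈ d → a + c ≈ b + d
  +-cong {a} {b} {c} {d} (mk≈ p) (mk≈ r) =
    by (trans (regroup (+ a) (+ b) (+ c) (+ d)) (sym (cong₂ ℤ._-_ (ℤₚ.pos-+ a c) (ℤₚ.pos-+ b d))))
       (ℤ∣.∣m∣n⇒∣m+n p r)
    where
    regroup : ∀ x y z w → (x ℤ.- y) ℤ.+ (z ℤ.- w) ≡ (x ℤ.+ z) ℤ.- (y ℤ.+ w)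
    regroup = ℤ-Solver.solve-∀

  *-congˡ : ∀ c {a b} → a ≈ b → c * a ≈ c * b
  *-congˡ c {a} {b} (mk≈ p) =
    by (trans (distrib (+ c) (+ a) (+ b)) (sym (cong₂ ℤ._-_ (ℤₚ.pos-* c a) (ℤₚ.pos-* c b))))
       (ℤ∣.∣n⇒∣m*n (+ c) p)
    where
    distrib : ∀ x y z → x ℤ.* (y ℤ.- z) ≡ x ℤ.* y ℤ.- x ℤ.* z
    distrib = ℤ-Solver.solve-∀

  *-congʳ : ∀ c {a b} → a ≈ b → a * c ≈ b * c
  *-congʳ c {a} {b} a≈b = subst₂ _≈_ (ℕₚ.*-comm c a) (ℕₚ.*-comm c b) (*-congˡ c a≈b)

  +-cancelʳ : ∀ {a b c} → a + c ≈ b + c → a ≈ b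
  +-cancelʳ {a} {b} {c} (mk≈ p) =
    by (trans (cong₂ ℤ._-_ (ℤₚ.pos-+ a c) (ℤₚ.pos-+ b c)) (cancel (+ a) (+ b) (+ c))) p
    where
    cancel : ∀ x y z → (x ℤ.+ z) ℤ.- (y ℤ.+ z) ≡ x ℤ.- y
    cancel = ℤ-Solver.solve-∀

  ≈0⇒∣ : ∀ {a} → a ≈ 0 → Δ ∣ a
  ≈0⇒∣ {a} (mk≈ p) = subst (Δ ∣_) (ℕₚ.+-identityʳ a) (ℤ∣.∣⇒∣ᵤ p)

  fromMod : ∀ {a b} → a ≡ b [mod Δ ] → a ≈ b
  fromMod p = mk≈ (ℤ∣.∣ᵤ⇒∣ p)

  toMod : ∀ {a b} → a ≈ b → a ≡ b [mod Δ ]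
  toMod (mk≈ p) = ℤ∣.∣⇒∣ᵤ p

  sum-cong-≈ : ∀ {m} {f g : Fin m → ℕ} → (∀ i → f i ≈ g i) → sum f ≈ sum g
  sum-cong-≈ {zero}  f≈g = ≈-refl
  sum-cong-≈ {suc m} f≈g = +-cong (f≈g zero) (sum-cong-≈ (f≈g ∘ suc))

𝟙[_] : ∀ {P : Set} → Dec P → ℕ
𝟙[ yes _ ] = 1
𝟙[ no _ ]  = 0

𝟙-cong : ∀ {P Q : Set} (p : Dec P) (r : Dec Q) → (P → Q) → (Q → P) → 𝟙[ p ] ≡ 𝟙[ r ]
𝟙-cong (yes _) (yes _) _   _   = refl
𝟙-cong (yes p) (no ¬r) p→r _   = ⊥-elim (¬r (p→r p))
𝟙-cong (no ¬p) (yes r) _   r→p = ⊥-elim (¬p (r→p r))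
𝟙-cong (no _)  (no _)  _   _   = refl

𝟙-yes : ∀ {P : Set} → P → (d : Dec P) → 𝟙[ d ] ≡ 1
𝟙-yes p (yes _) = refl
𝟙-yes p (no ¬p) = ⊥-elim (¬p p)

𝟙-no : ∀ {P : Set} → ¬ P → (d : Dec P) → 𝟙[ d ] ≡ 0
𝟙-no ¬p (yes p) = ⊥-elim (¬p p)
𝟙-no ¬p (no _)  = refl

𝟙-+-𝟙-¬ : ∀ {P : Set} (d : Dec P) → 𝟙[ d ] + 𝟙[ ¬? d ] ≡ 1
𝟙-+-𝟙-¬ (yes _) = refl
𝟙-+-𝟙-¬ (no _)  = refl

length-filter≡sum-𝟙 : ∀ {A : Set} {P : A → Set} (P? : ∀ x → Dec (P x)) {m} (f : Fin m → A) →
                      length (filter P? (tabulate f)) ≡ sum (λ j → 𝟙[ P? (f j) ])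
length-filter≡sum-𝟙 P? {zero}  f = refl
length-filter≡sum-𝟙 P? {suc m} f with P? (f zero)
... | yes _ = cong suc (length-filter≡sum-𝟙 P? (f ∘ suc))
... | no _  = length-filter≡sum-𝟙 P? (f ∘ suc)

sum-const : ∀ {m} c → sum {m} (λ _ → c) ≡ m * c
sum-const {zero}  c = refl
sum-const {suc m} c = cong (c +_) (sum-const {m} c)

sum-𝟙-≟ : ∀ {m} (j : Fin m) (f : Fin m → ℕ) → sum (λ i → 𝟙[ i Fin.≟ j ] * f i) ≡ f j
sum-𝟙-≟ {suc m} zero f = begin
  f zero + 0 + sum {m} (λ _ → 0) ≡⟨ cong (f zero + 0 +_) (trans (sum-const {m} 0) (ℕₚ.*-zeroʳ m)) ⟩
  f zero + 0 + 0                 ≡⟨ trans (ℕₚ.+-identityʳ _) (ℕₚ.+-identityʳ _) ⟩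
  f zero                         ∎
  where open ≡-Reasoning
sum-𝟙-≟ {suc m} (suc j) f = begin
  sum {m} (λ i → 𝟙[ suc i Fin.≟ suc j ] * f (suc i))
    ≡⟨ sum-cong-≗ {m} (λ i → cong (_* f (suc i)) (𝟙-suc i)) ⟩
  sum {m} (λ i → 𝟙[ i Fin.≟ j ] * f (suc i))
    ≡⟨ sum-𝟙-≟ j (f ∘ suc) ⟩
  f (suc j)
    ∎
  where
  open ≡-Reasoning
  𝟙-suc : ∀ i → 𝟙[ suc i Fin.≟ suc j ] ≡ 𝟙[ i Fin.≟ j ]
  𝟙-suc i = 𝟙-cong (suc i Fin.≟ suc j) (i Fin.≟ j) Finₚ.suc-injective (cong suc)

commutativeRing : ∀ {q} → FiniteField q → CommutativeRing _ _
commutativeRing F = record { isCommutativeRing = FiniteField.isCommutativeRing F }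

module LinearAlgebra {q : ℕ} (F : FiniteField q) where

  open FiniteField F renaming (_+_ to _⊕_; _*_ to _⊗_; -_ to ⊖_)
  open Geometry F

  private
    module R = CommutativeRing (commutativeRing F)
    open import Algebra.Properties.Group R.+-group using (x∙y⁻¹≈ε⇒x≈y)
    open import Algebra.Properties.Ring R.ring using (-‿distribˡ-*)
    open import Algebra.Properties.CommutativeSemigroup R.+-commutativeSemigroup using (interchange)
    open import Algebra.Properties.CommutativeSemigroup R.*-commutativeSemigroup
      using (x∙yz≈y∙xz; x∙yz≈yx∙z; xy∙z≈yz∙x)

    variable
      v : ℕ
      a b x y : Vector v

  infixl 6 _⊞_
  infixr 7 _·_

  _⊞_ : Vector v → Vector v → Vector v
  _⊞_ = zipWith _⊕_

  _·_ : Carrier → Vector v → Vector v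
  c · a = map (c ⊗_) a

  unit : Fin v → Vector v
  unit zero    = 1# ∷ zeroVec
  unit (suc i) = 0# ∷ unit i

  dot-cong : a ≗ b → x ≗ y → dot a x ≡ dot b y
  dot-cong {zero}  a≗b x≗y = refl
  dot-cong {suc v} a≗b x≗y =
    cong₂ _⊕_ (cong₂ _⊗_ (a≗b zero) (x≗y zero)) (dot-cong (a≗b ∘ suc) (x≗y ∘ suc))

  dot-congˡ : a ≗ b → ∀ x → dot a x ≡ dot b x
  dot-congˡ a≗b x = dot-cong a≗b (λ _ → refl)

  dot-⊞ˡ : ∀ (a b x : Vector v) → dot (a ⊞ b) x ≡ dot a x ⊕ dot b x
  dot-⊞ˡ {zero}  a b x = sym (R.+-identityʳ 0#)
  dot-⊞ˡ {suc v} a b x =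
    trans (cong₂ _⊕_ (R.distribʳ (x zero) (a zero) (b zero)) (dot-⊞ˡ (a ∘ suc) (b ∘ suc) (x ∘ suc)))
          (interchange _ _ _ _)

  dot-·ˡ : ∀ c (a x : Vector v) → dot (c · a) x ≡ c ⊗ dot a x
  dot-·ˡ {zero}  c a x = sym (R.zeroʳ c)
  dot-·ˡ {suc v} c a x =
    trans (cong₂ _⊕_ (R.*-assoc c (a zero) (x zero)) (dot-·ˡ c (a ∘ suc) (x ∘ suc)))
          (sym (R.distribˡ c _ _))

  dot-·ʳ : ∀ c (a x : Vector v) → dot a (c · x) ≡ c ⊗ dot a x
  dot-·ʳ {zero}  c a x = sym (R.zeroʳ c)
  dot-·ʳ {suc v} c a x =
    trans (cong₂ _⊕_ (x∙yz≈y∙xz (a zero) c (x zero)) (dot-·ʳ c (a ∘ suc) (x ∘ suc)))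
          (sym (R.distribˡ c _ _))

  dot-⊞-·ˡ : ∀ (a b : Vector v) t x → dot (a ⊞ t · b) x ≡ dot a x ⊕ t ⊗ dot b x
  dot-⊞-·ˡ a b t x = trans (dot-⊞ˡ a (t · b) x) (cong (dot a x ⊕_) (dot-·ˡ t b x))

  dot-zeroˡ : (∀ i → a i ≡ 0#) → dot a x ≡ 0#
  dot-zeroˡ {zero}          a≡0 = refl
  dot-zeroˡ {suc v} {x = x} a≡0 =
    trans (cong₂ _⊕_ (trans (cong (_⊗ x zero) (a≡0 zero)) (R.zeroˡ (x zero))) (dot-zeroˡ (a≡0 ∘ suc)))
          (R.+-identityʳ 0#)

  dot-unit : ∀ (i : Fin v) (x : Vector v) → dot (unit i) x ≡ x i
  dot-unit zero x =
    trans (cong₂ _⊕_ (R.*-identityˡ (x zero)) (dot-zeroˡ {x = x ∘ suc} (λ _ → refl))) (R.+-identityʳ (x zero))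
  dot-unit (suc i) x =
    trans (cong₂ _⊕_ (R.zeroˡ (x zero)) (dot-unit i (x ∘ suc))) (R.+-identityˡ _)

  nonzero-coordinate : NonZeroVec x → Σ (Fin v) λ i → x i ≢ 0#
  nonzero-coordinate {v} {x} = Finₚ.¬∀⟶∃¬ v (λ i → x i ≡ 0#) (λ i → x i ≟ 0#)

  rescale-to-1 : ∀ (a x : Vector v) → dot a x ≢ 0# → Σ Carrier λ c → dot (c · a) x ≡ 1#
  rescale-to-1 a x ax≢0 with inverse (dot a x) ax≢0
  ... | c , ax*c≡1 = c , trans (dot-·ˡ c a x) (trans (R.*-comm c _) ax*c≡1)

  ∃-dot≡1 : NonZeroVec x → Σ (Vector v) λ a → dot a x ≡ 1#
  ∃-dot≡1 {x = x} x≢0 with nonzero-coordinate x≢0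
  ... | i , xᵢ≢0 with rescale-to-1 (unit i) x (xᵢ≢0 ∘ trans (sym (dot-unit i x)))
  ...   | c , eq = c · unit i , eq

  -- dot (minor g i k) x is the 2×2 minor of the pair (g, x) in the coordinates i and k.
  minor : Vector v → Fin v → Fin v → Vector v
  minor g i k = g k · unit i ⊞ (⊖ g i) · unit k

  dot-minor : ∀ (g : Vector v) i k x → dot (minor g i k) x ≡ g k ⊗ x i ⊕ ⊖ (g i ⊗ x k)
  dot-minor g i k x =
    trans (dot-⊞ˡ _ _ x)
          (cong₂ _⊕_ (trans (dot-·ˡ (g k) (unit i) x) (cong (g k ⊗_) (dot-unit i x)))
                     (trans (dot-·ˡ (⊖ g i) (unit k) x)
                            (trans (cong (⊖ g i ⊗_) (dot-unit k x)) (sym (-‿distribˡ-* (g i) (x k))))))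

  dot-minor-self : ∀ (g : Vector v) i k → dot (minor g i k) g ≡ 0#
  dot-minor-self g i k =
    trans (dot-minor g i k g)
          (trans (cong (λ z → g k ⊗ g i ⊕ ⊖ z) (R.*-comm (g i) (g k))) (R.-‿inverseʳ _))

  minors-vanish⇒samePoint : ∀ {g w : Vector v} {i} → NonZeroVec w → g i ≢ 0# →
                            (∀ k → dot (minor g i k) w ≡ 0#) → SamePoint g w
  minors-vanish⇒samePoint {g = g} {w} {i} w≢0 gᵢ≢0 minors≡0 with inverse (g i) gᵢ≢0
  ... | y , gᵢy≡1 = w i ⊗ y , c≢0 , w≡c·g
    where
    cross : ∀ k → g k ⊗ w i ≡ g i ⊗ w k
    cross k = x∙y⁻¹≈ε⇒x≈y _ _ (trans (sym (dot-minor g i k w)) (minors≡0 k))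
    w≡c·g : ∀ k → w k ≡ (w i ⊗ y) ⊗ g k
    w≡c·g k = begin
      w k                ≡⟨ R.*-identityʳ (w k) ⟨
      w k ⊗ 1#           ≡⟨ cong (w k ⊗_) gᵢy≡1 ⟨
      w k ⊗ (g i ⊗ y)    ≡⟨ x∙yz≈yx∙z (w k) (g i) y ⟩
      (g i ⊗ w k) ⊗ y    ≡⟨ cong (_⊗ y) (cross k) ⟨
      (g k ⊗ w i) ⊗ y    ≡⟨ xy∙z≈yz∙x (g k) (w i) y ⟩
      (w i ⊗ y) ⊗ g k    ∎
      where open ≡-Reasoning
    c≢0 : w i ⊗ y ≢ 0#
    c≢0 c≡0 = w≢0 (λ k → trans (w≡c·g k) (trans (cong (_⊗ g k) c≡0) (R.zeroˡ (g k))))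

  ∃-dot≡0-dot≡1 : ∀ {g w : Vector v} → NonZeroVec g → NonZeroVec w → ¬ SamePoint g w →
                  Σ (Vector v) λ a → dot a g ≡ 0# × dot a w ≡ 1#
  ∃-dot≡0-dot≡1 {v} {g} {w} g≢0 w≢0 g≁w with nonzero-coordinate g≢0
  ... | i , gᵢ≢0 with Finₚ.all? (λ k → dot (minor g i k) w ≟ 0#)
  ...   | yes minors≡0 = ⊥-elim (g≁w (minors-vanish⇒samePoint w≢0 gᵢ≢0 minors≡0))
  ...   | no ¬minors≡0 with Finₚ.¬∀⟶∃¬ v _ (λ k → dot (minor g i k) w ≟ 0#) ¬minors≡0
  ...     | k , mw≢0 with rescale-to-1 (minor g i k) w mw≢0
  ...       | c , eq = c · minor g i k
                     , trans (dot-·ˡ c _ g) (trans (cong (c ⊗_) (dot-minor-self g i k)) (R.zeroʳ c))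
                     , eq

  samePoint-refl : SamePoint x x
  samePoint-refl = 1# , (λ 1≡0 → 0≢1 (sym 1≡0)) , (λ i → sym (R.*-identityˡ _))

  samePoint-in-dimension-1 : ∀ {g w : Vector 1} → NonZeroVec g → NonZeroVec w → SamePoint g w
  samePoint-in-dimension-1 {g} {w} g≢0 w≢0 with nonzero-coordinate g≢0
  ... | zero , g₀≢0 = minors-vanish⇒samePoint w≢0 g₀≢0 λ { zero →
          trans (dot-minor g zero zero w) (R.-‿inverseʳ _) }

module Summation {q : ℕ} (F : FiniteField q) where

  open FiniteField F renaming (_+_ to _⊕_; _*_ to _⊗_; -_ to ⊖_)
  open Geometry F
  open LinearAlgebra F

  private
    open import Algebra.Properties.Group (CommutativeRing.+-group (commutativeRing F))
      using (//-rightDividesˡ; //-rightDividesʳ)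

    variable
      v : ℕ

    to : Fin q → Carrier
    to = Inverse.to enumeration

    from : Carrier → Fin q
    from = Inverse.from enumeration

  -- opaque, so that unifying sumF h with sumF k does not unfold the enumeration of F
  opaque

    sumF : (Carrier → ℕ) → ℕ
    sumF h = sum (h ∘ to)

    sumF-cong : ∀ {h k : Carrier → ℕ} → h ≗ k → sumF h ≡ sumF k
    sumF-cong h≗k = sum-cong-≗ {q} (h≗k ∘ to)

    sumF-+ : ∀ (h k : Carrier → ℕ) → sumF (λ x → h x + k x) ≡ sumF h + sumF k
    sumF-+ h k = ∑-distrib-+ (h ∘ to) (k ∘ to)

    sumF-*ˡ : ∀ c (h : Carrier → ℕ) → sumF (λ x → c * h x) ≡ c * sumF h
    sumF-*ˡ c h = sym (*-distribˡ-sum c (h ∘ to))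

    sumF-const : ∀ c → sumF (λ _ → c) ≡ q * c
    sumF-const = sum-const {q}

    sumF-cong-≈ : ∀ Δ {h k : Carrier → ℕ} → (∀ x → Congruence._≈_ Δ (h x) (k x)) →
                  Congruence._≈_ Δ (sumF h) (sumF k)
    sumF-cong-≈ Δ h≈k = Congruence.sum-cong-≈ Δ (h≈k ∘ to)

    sumF-↔ : (σ : Carrier ↔ Carrier) (h : Carrier → ℕ) → sumF (h ∘ Inverse.to σ) ≡ sumF h
    sumF-↔ σ h = sym (trans (sum-permute (h ∘ to) (↔-sym enumeration ↔-∘ (σ ↔-∘ enumeration)))
                            (sum-cong-≗ {q} (λ i → cong h (Inverse.strictlyInverseˡ enumeration _))))

    sumF-𝟙-≟ : ∀ c (h : Carrier → ℕ) → sumF (λ x → 𝟙[ x ≟ c ] * h x) ≡ h c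
    sumF-𝟙-≟ c h = begin
      sum (λ i → 𝟙[ to i ≟ c ] * h (to i))
        ≡⟨ sum-cong-≗ {q} (λ i → cong (_* h (to i)) (𝟙-to i)) ⟩
      sum (λ i → 𝟙[ i Fin.≟ from c ] * h (to i))
        ≡⟨ sum-𝟙-≟ (from c) (h ∘ to) ⟩
      h (to (from c))
        ≡⟨ cong h (Inverse.strictlyInverseˡ enumeration c) ⟩
      h c
        ∎
      where
      open ≡-Reasoning
      to≡⇒≡from : ∀ {i} → to i ≡ c → i ≡ from c
      to≡⇒≡from {i} eq = trans (sym (Inverse.strictlyInverseʳ enumeration i)) (cong from eq)
      ≡from⇒to≡ : ∀ {i} → i ≡ from c → to i ≡ c
      ≡from⇒to≡ refl = Inverse.strictlyInverseˡ enumeration c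
      𝟙-to : ∀ i → 𝟙[ to i ≟ c ] ≡ 𝟙[ i Fin.≟ from c ]
      𝟙-to i = 𝟙-cong (to i ≟ c) (i Fin.≟ from c) to≡⇒≡from ≡from⇒to≡

    sumF-comm : ∀ (f : Carrier → Carrier → ℕ) →
                sumF (λ x → sumF (f x)) ≡ sumF (λ y → sumF (λ x → f x y))
    sumF-comm f = ∑-comm (λ i j → f (to i) (to j))

  sumF-translate : ∀ c (h : Carrier → ℕ) → sumF (λ x → h (x ⊕ c)) ≡ sumF h
  sumF-translate c = sumF-↔ (mk↔ₛ′ (_⊕ c) (_⊕ ⊖ c) (//-rightDividesˡ c) (//-rightDividesʳ c))

  sumF-𝟙 : ∀ y → sumF (λ x → 𝟙[ y ≟ x ]) ≡ 1
  sumF-𝟙 y = trans (sumF-cong (λ x → trans (𝟙-cong (y ≟ x) (x ≟ y) sym sym) (sym (ℕₚ.*-identityʳ _))))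
                   (sumF-𝟙-≟ y (λ _ → 1))

  sumV : ∀ v → (Vector v → ℕ) → ℕ
  sumV zero    h = h zeroVec
  sumV (suc v) h = sumF (λ x → sumV v (h ∘ (x ∷_)))

  sumV-cong : ∀ v {h k : Vector v → ℕ} → h ≗ k → sumV v h ≡ sumV v k
  sumV-cong zero    h≗k = h≗k zeroVec
  sumV-cong (suc v) h≗k = sumF-cong (λ x → sumV-cong v (h≗k ∘ (x ∷_)))

  sumV-+ : ∀ v (h k : Vector v → ℕ) → sumV v (λ a → h a + k a) ≡ sumV v h + sumV v k
  sumV-+ zero    h k = refl
  sumV-+ (suc v) h k =
    trans (sumF-cong (λ x → sumV-+ v (h ∘ (x ∷_)) (k ∘ (x ∷_))))
          (sumF-+ (λ x → sumV v (h ∘ (x ∷_))) (λ x → sumV v (k ∘ (x ∷_))))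

  sumV-*ˡ : ∀ v c (h : Vector v → ℕ) → sumV v (λ a → c * h a) ≡ c * sumV v h
  sumV-*ˡ zero    c h = refl
  sumV-*ˡ (suc v) c h =
    trans (sumF-cong (λ x → sumV-*ˡ v c (h ∘ (x ∷_))))
          (sumF-*ˡ c (λ x → sumV v (h ∘ (x ∷_))))

  sumV-const : ∀ v c → sumV v (λ _ → c) ≡ q ^ v * c
  sumV-const zero    c = sym (ℕₚ.+-identityʳ c)
  sumV-const (suc v) c =
    trans (sumF-cong (λ _ → sumV-const v c))
          (trans (sumF-const (q ^ v * c)) (sym (ℕₚ.*-assoc q (q ^ v) c)))

  sumV-sum : ∀ v {m} (f : Vector v → Fin m → ℕ) →
             sumV v (λ a → sum (f a)) ≡ sum (λ j → sumV v (λ a → f a j))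
  sumV-sum v {zero}  f = trans (sumV-const v 0) (ℕₚ.*-zeroʳ (q ^ v))
  sumV-sum v {suc m} f =
    trans (sumV-+ v (λ a → f a zero) (λ a → sum (f a ∘ suc)))
          (cong (sumV v (λ a → f a zero) +_) (sumV-sum v (λ a → f a ∘ suc)))

  sumV-sumF : ∀ v (f : Vector v → Carrier → ℕ) →
              sumV v (λ a → sumF (f a)) ≡ sumF (λ t → sumV v (λ a → f a t))
  sumV-sumF zero    f = refl
  sumV-sumF (suc v) f =
    trans (sumF-cong (λ x → sumV-sumF v (f ∘ (x ∷_))))
          (sumF-comm (λ x t → sumV v (λ a → f (x ∷ a) t)))

  private
    ∷-cong : ∀ {x} {a b : Vector v} → a ≗ b → (x ∷ a) ≗ (x ∷ b)
    ∷-cong a≗b zero    = refl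
    ∷-cong a≗b (suc i) = a≗b i

  sumV-translate : ∀ v {h : Vector v → ℕ} → h Preserves _≗_ ⟶ _≡_ →
                   ∀ b → sumV v (λ a → h (a ⊞ b)) ≡ sumV v h
  sumV-translate zero    h-cong b = h-cong (λ ())
  sumV-translate (suc v) {h} h-cong b = begin
    sumF (λ x → sumV v (λ a → h ((x ∷ a) ⊞ b)))
      ≡⟨ sumF-cong (λ x → sumV-cong v (λ a → h-cong {(x ∷ a) ⊞ b} (λ { zero → refl ; (suc j) → refl }))) ⟩
    sumF (λ x → sumV v (λ a → h ((x ⊕ b zero) ∷ (a ⊞ (b ∘ suc)))))
      ≡⟨ sumF-cong (λ x → sumV-translate v (h-cong ∘ ∷-cong) (b ∘ suc)) ⟩
    sumF (λ x → sumV v (λ a → h ((x ⊕ b zero) ∷ a)))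
      ≡⟨ sumF-translate (b zero) (λ x → sumV v (h ∘ (x ∷_))) ⟩
    sumF (λ x → sumV v (h ∘ (x ∷_)))
      ∎
    where open ≡-Reasoning

  isZero? : ∀ (a : Vector v) → Dec (∀ i → a i ≡ 0#)
  isZero? a = Finₚ.all? (λ i → a i ≟ 0#)

  𝟙-isZero-∷ : ∀ x (a : Vector v) → 𝟙[ isZero? (x ∷ a) ] ≡ 𝟙[ x ≟ 0# ] * 𝟙[ isZero? a ]
  𝟙-isZero-∷ x a = by-cases (x ≟ 0#) (isZero? a)
    where
    by-cases : (x≟0 : Dec (x ≡ 0#)) (a≟0 : Dec (∀ i → a i ≡ 0#)) →
               𝟙[ isZero? (x ∷ a) ] ≡ 𝟙[ x≟0 ] * 𝟙[ a≟0 ]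
    by-cases (yes x≡0) (yes a≡0) = 𝟙-yes (λ { zero → x≡0 ; (suc i) → a≡0 i }) (isZero? (x ∷ a))
    by-cases (no x≢0)  _         = 𝟙-no (λ x∷a≡0 → x≢0 (x∷a≡0 zero)) (isZero? (x ∷ a))
    by-cases (yes _)   (no a≢0)  = 𝟙-no (λ x∷a≡0 → a≢0 (x∷a≡0 ∘ suc)) (isZero? (x ∷ a))

  sumV-𝟙-isZero : ∀ v {h : Vector v → ℕ} → h Preserves _≗_ ⟶ _≡_ →
                  sumV v (λ a → 𝟙[ isZero? a ] * h a) ≡ h zeroVec
  sumV-𝟙-isZero zero    h-cong = ℕₚ.+-identityʳ _
  sumV-𝟙-isZero (suc v) {h} h-cong = begin
    sumF (λ x → sumV v (λ a → 𝟙[ isZero? (x ∷ a) ] * h (x ∷ a)))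
      ≡⟨ sumF-cong (λ x → sumV-cong v (split-head x)) ⟩
    sumF (λ x → sumV v (λ a → 𝟙[ x ≟ 0# ] * (𝟙[ isZero? a ] * h (x ∷ a))))
      ≡⟨ sumF-cong (λ x → sumV-*ˡ v 𝟙[ x ≟ 0# ] _) ⟩
    sumF (λ x → 𝟙[ x ≟ 0# ] * sumV v (λ a → 𝟙[ isZero? a ] * h (x ∷ a)))
      ≡⟨ sumF-cong (λ x → cong (𝟙[ x ≟ 0# ] *_) (sumV-𝟙-isZero v (h-cong ∘ ∷-cong))) ⟩
    sumF (λ x → 𝟙[ x ≟ 0# ] * h (x ∷ zeroVec))
      ≡⟨ sumF-𝟙-≟ 0# (λ x → h (x ∷ zeroVec)) ⟩
    h (0# ∷ zeroVec)
      ≡⟨ h-cong {0# ∷ zeroVec} {zeroVec} (λ { zero → refl ; (suc i) → refl }) ⟩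
    h zeroVec
      ∎
    where
    open ≡-Reasoning
    split-head : ∀ x a → 𝟙[ isZero? (x ∷ a) ] * h (x ∷ a) ≡ 𝟙[ x ≟ 0# ] * (𝟙[ isZero? a ] * h (x ∷ a))
    split-head x a = trans (cong (_* h (x ∷ a)) (𝟙-isZero-∷ x a))
                           (ℕₚ.*-assoc 𝟙[ x ≟ 0# ] 𝟙[ isZero? a ] (h (x ∷ a)))

  sumNonzero : ∀ v → (Vector v → ℕ) → ℕ
  sumNonzero v h = sumV v (λ a → 𝟙[ ¬? (isZero? a) ] * h a)

  sumV-split-zero : ∀ v {h : Vector v → ℕ} → h Preserves _≗_ ⟶ _≡_ →
                    sumV v h ≡ h zeroVec + sumNonzero v h
  sumV-split-zero v {h} h-cong = begin
    sumV v h
      ≡⟨ sumV-cong v (λ a → trans (sym (ℕₚ.*-identityˡ (h a)))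
                                   (cong (_* h a) (sym (𝟙-+-𝟙-¬ (isZero? a))))) ⟩
    sumV v (λ a → (𝟙[ isZero? a ] + 𝟙[ ¬? (isZero? a) ]) * h a)
      ≡⟨ sumV-cong v (λ a → ℕₚ.*-distribʳ-+ (h a) 𝟙[ isZero? a ] 𝟙[ ¬? (isZero? a) ]) ⟩
    sumV v (λ a → 𝟙[ isZero? a ] * h a + 𝟙[ ¬? (isZero? a) ] * h a)
      ≡⟨ sumV-+ v _ _ ⟩
    sumV v (λ a → 𝟙[ isZero? a ] * h a) + sumNonzero v h
      ≡⟨ cong (_+ sumNonzero v h) (sumV-𝟙-isZero v h-cong) ⟩
    h zeroVec + sumNonzero v h
      ∎
    where open ≡-Reasoning

  sumV-cong-≈ : ∀ Δ v {h k : Vector v → ℕ} → (∀ a → Congruence._≈_ Δ (h a) (k a)) →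
                Congruence._≈_ Δ (sumV v h) (sumV v k)
  sumV-cong-≈ Δ zero    h≈k = h≈k zeroVec
  sumV-cong-≈ Δ (suc v) h≈k = sumF-cong-≈ Δ (λ x → sumV-cong-≈ Δ v (h≈k ∘ (x ∷_)))

module Counting {q : ℕ} (F : FiniteField q) where

  open FiniteField F renaming (_+_ to _⊕_; _*_ to _⊗_; -_ to ⊖_)
  open Geometry F
  open LinearAlgebra F
  open Summation F

  private
    module R = CommutativeRing (commutativeRing F)
    open import Algebra.Properties.Group R.+-group using (∙-cancelʳ)

    instance
      q-nonZero : ℕ.NonZero q
      q-nonZero = Finₚ.nonZeroIndex (Inverse.from enumeration 0#)

  module _ (v : ℕ) (ψ : Vector v → ℕ) (ψ-cong : ψ Preserves _≗_ ⟶ _≡_)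
           (w a₁ : Vector v) (a₁w≡1 : dot a₁ w ≡ 1#)
           (ψ-invariant : ∀ a t → ψ (a ⊞ t · a₁) ≡ ψ a) where

    private
      level : Carrier → ℕ
      level t = sumV v (λ a → ψ a * 𝟙[ dot a w ≟ t ])

      shift : ∀ a t → dot (a ⊞ t · a₁) w ≡ dot a w ⊕ t
      shift a t = trans (dot-⊞-·ˡ a a₁ t w)
                        (cong (dot a w ⊕_) (trans (cong (t ⊗_) a₁w≡1) (R.*-identityʳ t)))

      level-independent : ∀ t → level t ≡ level 0#
      level-independent t = begin
        level t
          ≡⟨ sumV-translate v summand-cong (t · a₁) ⟨
        sumV v (λ a → ψ (a ⊞ t · a₁) * 𝟙[ dot (a ⊞ t · a₁) w ≟ t ])
          ≡⟨ sumV-cong v (λ a → cong₂ _*_ (ψ-invariant a t) (𝟙-cong _ _ (on-level a) (to-level a))) ⟩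
        level 0#
          ∎
        where
        open ≡-Reasoning
        summand-cong : (λ a → ψ a * 𝟙[ dot a w ≟ t ]) Preserves _≗_ ⟶ _≡_
        summand-cong a≗b = cong₂ _*_ (ψ-cong a≗b) (cong (λ c → 𝟙[ c ≟ t ]) (dot-congˡ a≗b w))
        on-level : ∀ a → dot (a ⊞ t · a₁) w ≡ t → dot a w ≡ 0#
        on-level a eq = ∙-cancelʳ t _ _ (trans (sym (shift a t)) (trans eq (sym (R.+-identityˡ t))))
        to-level : ∀ a → dot a w ≡ 0# → dot (a ⊞ t · a₁) w ≡ t
        to-level a eq = trans (shift a t) (trans (cong (_⊕ t) eq) (R.+-identityˡ t))

    -- The translations a ↦ a + t·a₁ permute the level sets of a ↦ a·w transitively.
    sumV-level-set : ∀ s → q * sumV v (λ a → ψ a * 𝟙[ dot a w ≟ s ]) ≡ sumV v ψ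
    sumV-level-set s = begin
      q * level s
        ≡⟨ sumF-const (level s) ⟨
      sumF (λ _ → level s)
        ≡⟨ sumF-cong (λ t → trans (level-independent t) (sym (level-independent s))) ⟨
      sumF level
        ≡⟨ sumV-sumF v (λ a t → ψ a * 𝟙[ dot a w ≟ t ]) ⟨
      sumV v (λ a → sumF (λ t → ψ a * 𝟙[ dot a w ≟ t ]))
        ≡⟨ sumV-cong v (λ a → trans (sumF-*ˡ (ψ a) _) (cong (ψ a *_) (sumF-𝟙 (dot a w)))) ⟩
      sumV v (λ a → ψ a * 1)
        ≡⟨ sumV-cong v (λ a → ℕₚ.*-identityʳ (ψ a)) ⟩
      sumV v ψ
        ∎
      where open ≡-Reasoning

  card-dot≡ : ∀ v (g : Vector (suc v)) → NonZeroVec g →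
              ∀ s → sumV (suc v) (λ a → 𝟙[ dot a g ≟ s ]) ≡ q ^ v
  card-dot≡ v g g≢0 s with ∃-dot≡1 {x = g} g≢0
  ... | a₁ , a₁g≡1 = ℕₚ.*-cancelˡ-≡ _ _ q (begin
    q * sumV (suc v) (λ a → 𝟙[ dot a g ≟ s ])
      ≡⟨ cong (q *_) (sumV-cong (suc v) (λ a → sym (ℕₚ.*-identityˡ 𝟙[ dot a g ≟ s ]))) ⟩
    q * sumV (suc v) (λ a → 1 * 𝟙[ dot a g ≟ s ])
      ≡⟨ sumV-level-set (suc v) (λ _ → 1) (λ _ → refl) g a₁ a₁g≡1 (λ _ _ → refl) s ⟩
    sumV (suc v) (λ _ → 1)
      ≡⟨ trans (sumV-const (suc v) 1) (ℕₚ.*-identityʳ _) ⟩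
    q * q ^ v
      ∎)
    where open ≡-Reasoning

  card-dot≡0-dot≡1 : ∀ v (g w : Vector (suc (suc v))) →
                     NonZeroVec g → NonZeroVec w → ¬ SamePoint g w →
                     sumV (suc (suc v)) (λ a → 𝟙[ dot a g ≟ 0# ] * 𝟙[ dot a w ≟ 1# ]) ≡ q ^ v
  card-dot≡0-dot≡1 v g w g≢0 w≢0 g≁w with ∃-dot≡0-dot≡1 {g = g} {w} g≢0 w≢0 g≁w
  ... | a₁ , a₁g≡0 , a₁w≡1 = ℕₚ.*-cancelˡ-≡ _ _ q (begin
    q * sumV (suc (suc v)) (λ a → 𝟙[ dot a g ≟ 0# ] * 𝟙[ dot a w ≟ 1# ])
      ≡⟨ sumV-level-set (suc (suc v)) (λ a → 𝟙[ dot a g ≟ 0# ]) on-g⊥-cong w a₁ a₁w≡1 invariant 1# ⟩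
    sumV (suc (suc v)) (λ a → 𝟙[ dot a g ≟ 0# ])
      ≡⟨ card-dot≡ (suc v) g g≢0 0# ⟩
    q * q ^ v
      ∎)
    where
    open ≡-Reasoning
    on-g⊥-cong : (λ a → 𝟙[ dot a g ≟ 0# ]) Preserves _≗_ ⟶ _≡_
    on-g⊥-cong a≗b = cong (λ c → 𝟙[ c ≟ 0# ]) (dot-congˡ a≗b g)
    invariant : ∀ a t → 𝟙[ dot (a ⊞ t · a₁) g ≟ 0# ] ≡ 𝟙[ dot a g ≟ 0# ]
    invariant a t = cong (λ c → 𝟙[ c ≟ 0# ]) (begin
      dot (a ⊞ t · a₁) g      ≡⟨ dot-⊞-·ˡ a a₁ t g ⟩
      dot a g ⊕ t ⊗ dot a₁ g  ≡⟨ cong (λ c → dot a g ⊕ t ⊗ c) a₁g≡0 ⟩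
      dot a g ⊕ t ⊗ 0#        ≡⟨ cong (dot a g ⊕_) (R.zeroʳ t) ⟩
      dot a g ⊕ 0#            ≡⟨ R.+-identityʳ _ ⟩
      dot a g                 ∎)

  card-dot≡0-dot≡1-samePoint : ∀ v (g w : Vector v) → SamePoint g w →
                               sumV v (λ a → 𝟙[ dot a g ≟ 0# ] * 𝟙[ dot a w ≟ 1# ]) ≡ 0
  card-dot≡0-dot≡1-samePoint v g w (c , _ , w≡c·g) =
    trans (sumV-cong v empty) (trans (sumV-const v 0) (ℕₚ.*-zeroʳ (q ^ v)))
    where
    empty : ∀ a → 𝟙[ dot a g ≟ 0# ] * 𝟙[ dot a w ≟ 1# ] ≡ 0
    empty a with dot a g ≟ 0#
    ... | no _ = refl
    ... | yes ag≡0 = trans (ℕₚ.+-identityʳ _) (𝟙-no (λ aw≡1 → 0≢1 (trans (sym aw≡0) aw≡1)) (dot a w ≟ 1#))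
      where
      aw≡0 : dot a w ≡ 0#
      aw≡0 = begin
        dot a w        ≡⟨ dot-cong (λ _ → refl) w≡c·g ⟩
        dot a (c · g)  ≡⟨ dot-·ʳ c a g ⟩
        c ⊗ dot a g    ≡⟨ cong (c ⊗_) ag≡0 ⟩
        c ⊗ 0#         ≡⟨ R.zeroʳ c ⟩
        0#             ∎
        where open ≡-Reasoning

module WeaklyDivisiblePointSet {q : ℕ} (F : FiniteField q) (Δ : ℕ) {r n : ℕ}
         (C : Geometry.PointSet F (suc (suc r)) n) (j₀ : Fin n)
         (C≠P : Geometry.NotAllPoints F C) (weak : Divisibility.WeaklyDivisible F Δ C) where

  open FiniteField F using (0#; 1#; _≟_; 0≢1)
  open Geometry F
  open Divisibility F
  open PointSet C
  open LinearAlgebra F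
  open Summation F
  open Counting F
  open Congruence Δ

  private
    v : ℕ
    v = suc (suc r)

    u : ℕ
    u = proj₁ weak

    x : Vector v
    x = proj₁ C≠P

    x≢0 : NonZeroVec x
    x≢0 = proj₁ (proj₂ C≠P)

    x∉C : ∀ j → ¬ SamePoint (col j) x
    x∉C = proj₂ (proj₂ C≠P)

  -- hyperplaneCount C as a sum of indicators, so that it can be interchanged with sumV
  pointsOn : Vector v → ℕ
  pointsOn a = sum (λ j → 𝟙[ dot a (col j) ≟ 0# ])

  pointsOn-cong : pointsOn Preserves _≗_ ⟶ _≡_
  pointsOn-cong a≗b = sum-cong-≗ {n} (λ j → cong (λ c → 𝟙[ c ≟ 0# ]) (dot-congˡ a≗b (col j)))

  pointsOn-zero : ∀ {a} → (∀ i → a i ≡ 0#) → pointsOn a ≡ n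
  pointsOn-zero a≡0 =
    trans (sum-cong-≗ {n} (λ j → 𝟙-yes (dot-zeroˡ {x = col j} a≡0) _))
          (trans (sum-const {n} 1) (ℕₚ.*-identityʳ n))

  pointsOn≈u : ∀ a → NonZeroVec a → pointsOn a ≈ u
  pointsOn≈u a a≢0 =
    ≈-trans (≡⇒≈ (sym (length-filter≡sum-𝟙 (λ j → dot a (col j) ≟ 0#) (λ j → j))))
            (fromMod (proj₂ weak a a≢0))

  affineSum : Vector v → ℕ
  affineSum w = sumV v (λ a → pointsOn a * 𝟙[ dot a w ≟ 1# ])

  affineSum-by-points : ∀ w →
    affineSum w ≡ sum (λ j → sumV v (λ a → 𝟙[ dot a (col j) ≟ 0# ] * 𝟙[ dot a w ≟ 1# ]))
  affineSum-by-points w =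
    trans (sumV-cong v (λ a → *-distribʳ-sum 𝟙[ dot a w ≟ 1# ] (λ j → 𝟙[ dot a (col j) ≟ 0# ])))
          (sumV-sum v (λ a j → 𝟙[ dot a (col j) ≟ 0# ] * 𝟙[ dot a w ≟ 1# ]))

  affineSum≈ : ∀ w → NonZeroVec w → affineSum w ≈ u * q ^ suc r
  affineSum≈ w w≢0 = begin
    affineSum w                              ≈⟨ sumV-cong-≈ Δ v pointwise ⟩
    sumV v (λ a → u * 𝟙[ dot a w ≟ 1# ])     ≡⟨ sumV-*ˡ v u (λ a → 𝟙[ dot a w ≟ 1# ]) ⟩
    u * sumV v (λ a → 𝟙[ dot a w ≟ 1# ])     ≡⟨ cong (u *_) (card-dot≡ (suc r) w w≢0 1#) ⟩
    u * q ^ suc r                            ∎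
    where
    open ≈-Reasoning
    pointwise : ∀ a → pointsOn a * 𝟙[ dot a w ≟ 1# ] ≈ u * 𝟙[ dot a w ≟ 1# ]
    pointwise a with dot a w ≟ 1#
    ... | no _     = ≡⇒≈ (trans (ℕₚ.*-zeroʳ (pointsOn a)) (sym (ℕₚ.*-zeroʳ u)))
    ... | yes aw≡1 = *-congʳ 1 (pointsOn≈u a (λ a≡0 → 0≢1 (trans (sym (dot-zeroˡ {x = w} a≡0)) aw≡1)))

  affineSum-outside : affineSum x ≡ n * q ^ r
  affineSum-outside = begin
    affineSum x
      ≡⟨ affineSum-by-points x ⟩
    sum (λ j → sumV v (λ a → 𝟙[ dot a (col j) ≟ 0# ] * 𝟙[ dot a x ≟ 1# ]))
      ≡⟨ sum-cong-≗ {n} (λ j → card-dot≡0-dot≡1 r (col j) x (nonzero j) x≢0 (x∉C j)) ⟩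
    sum {n} (λ _ → q ^ r)
      ≡⟨ sum-const {n} (q ^ r) ⟩
    n * q ^ r
      ∎
    where open ≡-Reasoning

  affineSum-on-C : affineSum (col j₀) + q ^ r ≡ n * q ^ r
  affineSum-on-C = begin
    affineSum (col j₀) + q ^ r
      ≡⟨ cong₂ _+_ (affineSum-by-points (col j₀)) (sym (sum-𝟙-≟ j₀ (λ _ → q ^ r))) ⟩
    sum meet + sum (λ j → 𝟙[ j Fin.≟ j₀ ] * q ^ r)
      ≡⟨ ∑-distrib-+ meet _ ⟨
    sum (λ j → meet j + 𝟙[ j Fin.≟ j₀ ] * q ^ r)
      ≡⟨ sum-cong-≗ {n} pointwise ⟩
    sum {n} (λ _ → q ^ r)
      ≡⟨ sum-const {n} (q ^ r) ⟩
    n * q ^ r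
      ∎
    where
    open ≡-Reasoning
    meet : Fin n → ℕ
    meet j = sumV v (λ a → 𝟙[ dot a (col j) ≟ 0# ] * 𝟙[ dot a (col j₀) ≟ 1# ])
    pointwise : ∀ j → meet j + 𝟙[ j Fin.≟ j₀ ] * q ^ r ≡ q ^ r
    pointwise j with j Fin.≟ j₀
    ... | yes refl = trans (cong (_+ (q ^ r + 0)) (card-dot≡0-dot≡1-samePoint v (col j₀) (col j₀) samePoint-refl))
                           (ℕₚ.+-identityʳ _)
    ... | no j≢j₀  = trans (cong (_+ 0) (card-dot≡0-dot≡1 r (col j) (col j₀) (nonzero j) (nonzero j₀) j≁j₀))
                           (ℕₚ.+-identityʳ _)
      where
      j≁j₀ : ¬ SamePoint (col j) (col j₀)
      j≁j₀ = j≢j₀ ∘ distinct j j₀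

  q^r≈0 : q ^ r ≈ 0
  q^r≈0 = +-cancelʳ (begin
    q ^ r + affineSum (col j₀)  ≡⟨ trans (ℕₚ.+-comm (q ^ r) _) affineSum-on-C ⟩
    n * q ^ r                   ≡⟨ affineSum-outside ⟨
    affineSum x                 ≈⟨ affineSum≈ x x≢0 ⟩
    u * q ^ suc r               ≈⟨ affineSum≈ (col j₀) (nonzero j₀) ⟨
    0 + affineSum (col j₀)      ∎)
    where open ≈-Reasoning

  multiple-of-q^r≈0 : ∀ k → k * q ^ r ≈ 0
  multiple-of-q^r≈0 k = ≈-trans (*-congˡ k q^r≈0) (≡⇒≈ (ℕₚ.*-zeroʳ k))

  incidences : sumV v pointsOn ≡ n * q ^ suc r
  incidences = begin
    sumV v pointsOn
      ≡⟨ sumV-sum v (λ a j → 𝟙[ dot a (col j) ≟ 0# ]) ⟩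
    sum (λ j → sumV v (λ a → 𝟙[ dot a (col j) ≟ 0# ]))
      ≡⟨ sum-cong-≗ {n} (λ j → card-dot≡ (suc r) (col j) (nonzero j) 0#) ⟩
    sum {n} (λ _ → q ^ suc r)
      ≡⟨ sum-const {n} (q ^ suc r) ⟩
    n * q ^ suc r
      ∎
    where open ≡-Reasoning

  n≈u : n ≈ u
  n≈u = +-cancelʳ (begin
    n + sumNonzero v (λ _ → u)                ≈⟨ +-cong (≈-refl {n}) (sumV-cong-≈ Δ v pointwise) ⟨
    n + sumNonzero v pointsOn                 ≡⟨ cong (_+ sumNonzero v pointsOn) (pointsOn-zero (λ _ → refl)) ⟨
    pointsOn zeroVec + sumNonzero v pointsOn  ≡⟨ sumV-split-zero v pointsOn-cong ⟨
    sumV v pointsOn                           ≡⟨ trans incidences (sym (ℕₚ.*-assoc n q (q ^ r))) ⟩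
    (n * q) * q ^ r                           ≈⟨ multiple-of-q^r≈0 (n * q) ⟩
    0                                         ≈⟨ multiple-of-q^r≈0 (q * q * u) ⟨
    (q * q * u) * q ^ r                       ≡⟨ trans (reorder q (q ^ r) u) (sym (sumV-const v u)) ⟩
    sumV v (λ _ → u)                          ≡⟨ sumV-split-zero v {λ _ → u} (λ _ → refl) ⟩
    u + sumNonzero v (λ _ → u)                ∎)
    where
    open ≈-Reasoning
    pointwise : ∀ a → 𝟙[ ¬? (isZero? a) ] * pointsOn a ≈ 𝟙[ ¬? (isZero? a) ] * u
    pointwise a with isZero? a
    ... | yes _  = ≈-refl
    ... | no a≢0 = *-congˡ 1 (pointsOn≈u a a≢0)
    reorder : ∀ q x u → (q * q * u) * x ≡ q * (q * x) * u
    reorder = ℕ-Solver.solve-∀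

  stronglyDivisible : StronglyDivisible Δ C
  stronglyDivisible a a≢0 = toMod (≈-trans (fromMod (proj₂ weak a a≢0)) (≈-sym n≈u))

  weight+pointsOn : ∀ y → weight C y + pointsOn y ≡ n
  weight+pointsOn y = begin
    weight C y + pointsOn y
      ≡⟨ cong (_+ pointsOn y) (length-filter≡sum-𝟙 (λ j → ¬? (dot y (col j) ≟ 0#)) (λ j → j)) ⟩
    sum (λ j → 𝟙[ ¬? (dot y (col j) ≟ 0#) ]) + pointsOn y
      ≡⟨ ∑-distrib-+ (λ j → 𝟙[ ¬? (dot y (col j) ≟ 0#) ]) (λ j → 𝟙[ dot y (col j) ≟ 0# ]) ⟨
    sum (λ j → 𝟙[ ¬? (dot y (col j) ≟ 0#) ] + 𝟙[ dot y (col j) ≟ 0# ])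
      ≡⟨ sum-cong-≗ {n} (λ j → trans (ℕₚ.+-comm 𝟙[ ¬? (dot y (col j) ≟ 0#) ] _)
                                     (𝟙-+-𝟙-¬ (dot y (col j) ≟ 0#))) ⟩
    sum {n} (λ _ → 1)
      ≡⟨ trans (sum-const {n} 1) (ℕₚ.*-identityʳ n) ⟩
    n ∎
    where open ≡-Reasoning

  weight-divisible : ∀ y → ¬ weight C y ≡ 0 → Δ ∣ weight C y
  weight-divisible y weight≢0 with isZero? y
  ... | yes y≡0 = ⊥-elim (weight≢0 (ℕₚ.+-cancelʳ-≡ (pointsOn y) (weight C y) 0
                                     (trans (weight+pointsOn y) (sym (pointsOn-zero y≡0)))))
  ... | no y≢0  = ≈0⇒∣ (+-cancelʳ (begin
    weight C y + pointsOn y  ≡⟨ weight+pointsOn y ⟩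
    n                        ≈⟨ n≈u ⟩
    u                        ≈⟨ pointsOn≈u y y≢0 ⟨
    0 + pointsOn y           ∎))
    where open ≈-Reasoning

theorem7 : (q : ℕ) → IsPrimePower q → (F : FiniteField q) →
  (v : ℕ) → v ≥ 1 → (Δ : ℕ) → Δ > 1 → (n : ℕ) → n ≥ 1 →
  (C : Geometry.PointSet F v n) →
  Geometry.NotAllPoints F C →
  Divisibility.WeaklyDivisible F Δ C →
  Divisibility.StronglyDivisible F Δ C
  × (∀ (x : Geometry.Vector F v) → ¬ (Geometry.weight F C x ≡ 0) → Δ ∣ Geometry.weight F C x)
  × Δ ∣ q ^ (v ∸ 2)
theorem7 q _ F zero          ()
theorem7 q _ F (suc v)       _ Δ _ zero    ()
theorem7 q _ F (suc zero)    _ Δ _ (suc n) _ C (x , x≢0 , x∉C) _ =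
  ⊥-elim (x∉C zero (LinearAlgebra.samePoint-in-dimension-1 F (Geometry.PointSet.nonzero C zero) x≢0))
theorem7 q _ F (suc (suc r)) _ Δ _ (suc n) _ C C≠P weak =
  stronglyDivisible , weight-divisible , Congruence.≈0⇒∣ Δ q^r≈0
  where open WeaklyDivisiblePointSet F Δ C zero C≠P weak
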